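{- Let $G$ be a finite, simple, connected graph of order $n$ with $\dim(G)=\mathrm{res}(G)=3$. Then: (a) For every pair $\{u,v\}\in \mathcal{P}_2(V(G))$ there exist unique pairs $\{x,y\},\{r,s\}\in \mathcal{P}_2(V(G))$ such that $\{x,y\}$ is not resolved by $\{u,v\}$, and $\{u,v\}$ is not resolved by $\{r,s\}$. (b) Every vertex $u\in V(G)$ satisfies $$\sum_{1\leq i\leq \mathrm{ecc}(u)} \binom{|N_i(u)|}{2}=n-1,$$ where $\mathrm{ecc}(u)=\max_{v\in V(G)} d(u,v)$ is the eccentricity of $u$.
   Context: All graphs are finite, simple and connected; $d(u,v)$ is the length of a shortest $u$-$v$ path. A vertex $w$ resolves a pair $\{x,y\}$ of vertices if $d(w,x)\neq d(w,y)$. A set $S\subseteq V(G)$ is a resolving set if every pair of vertices is resolved by some vertex of $S$; $\dim(G)$ (metric dimension) is the minimum size of a resolving set. The resolving number $\mathrm{res}(G)$ is the minimum $k$ such that every $k$-subset of $V(G)$ is a resolving set. $\mathcal{P}_\lambda(V(G))$ denotes the set of $\lambda$-subsets of $V(G)$. A pair $\{u,v\}$ resolves a pair $\{x,y\}$ if $u$ or $v$ resolves $\{x,y\}$. $N_i(u)$ is the set of vertices at distance exactly $i$ from $u$. -}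

module Defs where

open import Data.Nat using (ℕ; zero; suc; _≤_; _⊔_; _+_; _≟_)
open import Data.Bool using (Bool; true; false; T; _∧_; _∨_; if_then_else_)
open import Data.Fin using (Fin)
open import Data.Fin.Subset using (Subset; _∈_; ∣_∣)
open import Data.List using (List; foldr; map; allFin; filter; length; applyUpTo)
open import Data.Bool.ListAction using (any)
open import Data.Nat.ListAction using (sum)
open import Data.Nat.Combinatorics using (_C_)
open import Data.Product using (Σ; ∃; _×_; _,_)
open import Data.Sum using (_⊎_)
open import Relation.Binary.PropositionalEquality using (_≡_; _≢_)
open import Relation.Nullary using (¬_; does)
open import Data.Fin using () renaming (_≟_ to _≟ᶠ_)

record Graph (n : ℕ) : Set where
  field
    adj    : Fin n → Fin n → Bool
    sym    : ∀ u v → adj u v ≡ adj v u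
    irrefl : ∀ u → adj u u ≡ false

module _ {n : ℕ} (G : Graph n) where
  open Graph G

  _==_ : Fin n → Fin n → Bool
  u == v = does (u ≟ᶠ v)

  reach : ℕ → Fin n → Fin n → Bool
  reach zero    u v = u == v
  reach (suc k) u v = reach k u v ∨ any (λ w → reach k u w ∧ adj w v) (allFin n)

  Connected : Set
  Connected = ∀ u v → ∃ λ k → T (reach k u v)

  -- least k in [start, start + bound) with f k = true (else start + bound)
  firstTrue : (ℕ → Bool) → ℕ → ℕ → ℕ
  firstTrue f start zero      = start
  firstTrue f start (suc b)   = if f start then start else firstTrue f (suc start) b

  -- d(u,v): length of a shortest u-v path (for connected G it is < n)
  dist : Fin n → Fin n → ℕ
  dist u v = firstTrue (λ k → reach k u v) 0 n

  Resolves : Fin n → Fin n → Fin n → Set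
  Resolves w x y = dist w x ≢ dist w y

  ResolvingSet : Subset n → Set
  ResolvingSet S = ∀ x y → x ≢ y → ∃ λ w → w ∈ S × Resolves w x y

  IsMetricDim : ℕ → Set
  IsMetricDim k = (∃ λ S → ResolvingSet S × ∣ S ∣ ≡ k)
                × (∀ S → ResolvingSet S → k ≤ ∣ S ∣)

  AllResolving : ℕ → Set
  AllResolving k = ∀ S → ∣ S ∣ ≡ k → ResolvingSet S

  IsResNum : ℕ → Set
  IsResNum k = AllResolving k × (∀ m → AllResolving m → k ≤ m)

  PairResolves : Fin n → Fin n → Fin n → Fin n → Set
  PairResolves u v x y = Resolves u x y ⊎ Resolves v x y

  SamePair : Fin n → Fin n → Fin n → Fin n → Set
  SamePair x y x' y' = (x' ≡ x × y' ≡ y) ⊎ (x' ≡ y × y' ≡ x)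

  sphereSize : Fin n → ℕ → ℕ
  sphereSize u i = length (filter (λ v → dist u v ≟ i) (allFin n))

  ecc : Fin n → ℕ
  ecc u = foldr _⊔_ 0 (map (dist u) (allFin n))

  sphereSum : Fin n → ℕ
  sphereSum u = sum (map (λ i → sphereSize u i C 2) (applyUpTo suc (ecc u)))

-- Call a pair {u,v} of distinct vertices *blind* to a pair {x,y} of distinct
-- vertices when neither u nor v resolves {x,y}.  The hypotheses give:
--   dim(G) ≥ 3: no 2-set resolves, so every pair is blind to some pair;
--   res(G) ≤ 3: every 3-set resolves, so at most two vertices fail to
--               resolve a given pair {x,y}.
-- Count the ordered quadruples (u,v,x,y) with (u,v) blind to (x,y) in two
-- ways: each ordered (u,v) with u ≠ v contributes at least the two orders of
-- some pair, each ordered (x,y) with x ≠ y at most the two orders of its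
-- non-resolvers.  The totals agree, so both bounds are attained; this gives
-- part (a).  For part (b) fix u: a pair x ≠ y with d(u,x) = d(u,y) is not
-- resolved by u and by exactly one other vertex v, so such ordered pairs
-- number Σ_{v ≠ u} 2 = 2(n-1); grouping them by distance from u they number
-- Σ_i |N_i(u)|(|N_i(u)|-1) = 2 Σ_i C(|N_i(u)|,2).
module Submission where

open import Defs
open import Data.Nat as ℕ using (ℕ; zero; suc; _+_; _*_; _∸_; _≤_; _<_; _⊔_; z≤n; s≤s)
open import Data.Nat.Properties hiding (_≟_)
open import Data.Nat.Combinatorics using (_C_; nC1≡n; nCk+nC[k+1]≡[n+1]C[k+1])
open import Data.Nat.Solver using (module +-*-Solver)
import Data.Nat.ListAction as List
open import Data.Fin using (Fin; toℕ; _≟_) renaming (zero to fzero; suc to fsuc)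
open import Data.Fin.Properties using (any?)
open import Data.Fin.Subset using (Subset; _∈_; ∣_∣)
open import Data.Vec as Vec using (_∷_)
open import Data.Vec.Properties using (lookup∘tabulate; []=⇒lookup; lookup⇒[]=)
open import Data.List using (foldr; map; filter; length; applyUpTo; tabulate)
open import Data.Bool using (true; false; if_then_else_)
open import Data.Empty using (⊥; ⊥-elim)
open import Data.Product using (∃; ∃₂; _×_; _,_; proj₁; proj₂)
open import Data.Sum using (_⊎_; inj₁; inj₂)
open import Function using (_∘_; _$_)
open import Level using (0ℓ)
open import Relation.Binary.PropositionalEquality
open import Relation.Nullary using (¬_; Dec; yes; no; does)
open import Relation.Nullary.Decidable using (_×-dec_; ¬?)
open import Relation.Unary using (Pred; Decidable)
open import Relation.Unary.Properties using (_∪?_)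
open import Algebra.Properties.CommutativeMonoid.Sum +-0-commutativeMonoid
  using (sum; sum-syntax; sum-cong-≗; ∑-distrib-+; ∑-comm; sum-replicate-zero)
open import Algebra.Properties.Semiring.Sum +-*-semiring using (*-distribʳ-sum)
open import Algebra.Properties.CommutativeSemigroup +-commutativeSemigroup
  using (x∙yz≈y∙xz)

∑-mono : ∀ {n} {f g : Fin n → ℕ} → (∀ i → f i ≤ g i) → sum f ≤ sum g
∑-mono {zero}  f≤g = z≤n
∑-mono {suc n} f≤g = +-mono-≤ (f≤g fzero) (∑-mono (f≤g ∘ fsuc))

∑-zero : ∀ {n} {f : Fin n → ℕ} → (∀ i → f i ≡ 0) → sum f ≡ 0
∑-zero {n} f≡0 = trans (sum-cong-≗ f≡0) (sum-replicate-zero n)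

∑-const : ∀ n c → ∑[ i < n ] c ≡ n * c
∑-const zero    c = refl
∑-const (suc n) c = cong (c +_) (∑-const n c)

∑-ones : ∀ n → ∑[ i < n ] 1 ≡ n
∑-ones n = trans (∑-const n 1) (*-identityʳ n)

term≤∑ : ∀ {n} (f : Fin n → ℕ) i → f i ≤ sum f
term≤∑ f fzero    = m≤m+n _ _
term≤∑ f (fsuc i) = ≤-trans (term≤∑ (f ∘ fsuc) i) (m≤n+m _ _)

∑-nonzero : ∀ {n} (f : Fin n → ℕ) → sum f ≢ 0 → ∃ λ i → f i ≢ 0
∑-nonzero {zero}  f ∑≢0 = ⊥-elim (∑≢0 refl)
∑-nonzero {suc n} f ∑≢0 with f fzero ℕ.≟ 0
... | no f₀≢0 = fzero , f₀≢0
... | yes f₀≡0 with ∑-nonzero (f ∘ fsuc) (λ rest≡0 → ∑≢0 (cong₂ _+_ f₀≡0 rest≡0))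
...   | i , fᵢ≢0 = fsuc i , fᵢ≢0

except : ∀ {n} → Fin n → (Fin n → ℕ) → Fin n → ℕ
except a f i = if does (i ≟ a) then 0 else f i

except-≢ : ∀ {n} {a i : Fin n} (f : Fin n → ℕ) → i ≢ a → except a f i ≡ f i
except-≢ {a = a} {i} f i≢a with i ≟ a
... | yes i≡a = ⊥-elim (i≢a i≡a)
... | no  _   = refl

except-≡ : ∀ {n} {a i : Fin n} (f : Fin n → ℕ) → i ≡ a → except a f i ≡ 0
except-≡ {a = a} {i} f i≡a with i ≟ a
... | yes _   = refl
... | no  i≢a = ⊥-elim (i≢a i≡a)

except-support : ∀ {n} {a i : Fin n} (f : Fin n → ℕ) → except a f i ≢ 0 → i ≢ a × f i ≢ 0
except-support {a = a} {i} f nz with i ≟ a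
... | yes _   = ⊥-elim (nz refl)
... | no  i≢a = i≢a , nz

except-mono : ∀ {n} (a : Fin n) {f g : Fin n → ℕ} → (∀ i → f i ≤ g i) →
  ∀ i → except a f i ≤ except a g i
except-mono a f≤g i with i ≟ a
... | yes _ = z≤n
... | no  _ = f≤g i

except≤ : ∀ {n} (a : Fin n) (f : Fin n → ℕ) i → except a f i ≤ f i
except≤ a f i with i ≟ a
... | yes _ = z≤n
... | no  _ = ≤-refl

∑-except : ∀ {n} (f : Fin n → ℕ) a → sum f ≡ f a + sum (except a f)
∑-except f fzero    = refl
∑-except f (fsuc a) = trans (cong (f fzero +_) (∑-except (f ∘ fsuc) a))
                            (x∙yz≈y∙xz (f fzero) (f (fsuc a)) _)

∑-two : ∀ {n} (f : Fin n → ℕ) {a b} → a ≢ b → f a + f b ≤ sum f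
∑-two f {a} {b} a≢b = begin
  f a + f b                 ≡⟨ cong (f a +_) (except-≢ f (a≢b ∘ sym)) ⟨
  f a + except a f b        ≤⟨ +-monoʳ-≤ (f a) (term≤∑ (except a f) b) ⟩
  f a + sum (except a f)    ≡⟨ ∑-except f a ⟨
  sum f                     ∎
  where open ≤-Reasoning

∑-three : ∀ {n} (f : Fin n → ℕ) {a b c} → a ≢ b → a ≢ c → b ≢ c →
  f a + f b + f c ≤ sum f
∑-three f {a} {b} {c} a≢b a≢c b≢c = begin
  f a + f b + f c                        ≡⟨ +-assoc (f a) (f b) (f c) ⟩
  f a + (f b + f c)                      ≡⟨ cong₂ (λ p q → f a + (p + q))
                                              (except-≢ f (a≢b ∘ sym))
                                              (except-≢ f (a≢c ∘ sym)) ⟨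
  f a + (except a f b + except a f c)    ≤⟨ +-monoʳ-≤ (f a) (∑-two (except a f) b≢c) ⟩
  f a + sum (except a f)                 ≡⟨ ∑-except f a ⟨
  sum f                                  ∎
  where open ≤-Reasoning

∑-squeeze : ∀ {n} {f g : Fin n → ℕ} → (∀ i → f i ≤ g i) → sum g ≤ sum f →
  ∀ i → f i ≡ g i
∑-squeeze {f = f} {g} f≤g ∑g≤∑f i = ≤-antisym (f≤g i) (+-cancelʳ-≤ _ (g i) (f i) (begin
  g i + sum (except i g)  ≡⟨ ∑-except g i ⟨
  sum g                   ≤⟨ ∑g≤∑f ⟩
  sum f                   ≡⟨ ∑-except f i ⟩
  f i + sum (except i f)  ≤⟨ +-monoʳ-≤ (f i) (∑-mono (except-mono i f≤g)) ⟩
  f i + sum (except i g)  ∎))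
  where open ≤-Reasoning

∑-atMostOne : ∀ {n} (f : Fin n → ℕ) → (∀ i → f i ≤ 1) →
  (∀ i j → f i ≢ 0 → f j ≢ 0 → i ≡ j) → sum f ≤ 1
∑-atMostOne f f≤1 unique with sum f ℕ.≟ 0
... | yes ∑≡0 = subst (_≤ 1) (sym ∑≡0) z≤n
... | no  ∑≢0 with ∑-nonzero f ∑≢0
...   | a , fa≢0 = begin
  sum f                   ≡⟨ ∑-except f a ⟩
  f a + sum (except a f)  ≡⟨ cong (f a +_) (∑-zero rest≡0) ⟩
  f a + 0                 ≡⟨ +-identityʳ (f a) ⟩
  f a                     ≤⟨ f≤1 a ⟩
  1                       ∎
  where
  open ≤-Reasoning
  rest≡0 : ∀ i → except a f i ≡ 0
  rest≡0 i with except a f i ℕ.≟ 0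
  ... | yes e = e
  ... | no  nz with except-support f nz
  ...   | i≢a , fi≢0 = ⊥-elim (i≢a (unique i a fi≢0 fa≢0))

∑-atMostTwo : ∀ {n} (f : Fin n → ℕ) → (∀ i → f i ≤ 1) →
  (∀ {i j k} → f i ≢ 0 → f j ≢ 0 → f k ≢ 0 → i ≢ j → i ≢ k → j ≢ k → ⊥) →
  sum f ≤ 2
∑-atMostTwo f f≤1 noThree with sum f ℕ.≟ 0
... | yes ∑≡0 = subst (_≤ 2) (sym ∑≡0) z≤n
... | no  ∑≢0 with ∑-nonzero f ∑≢0
...   | a , fa≢0 = begin
  sum f                   ≡⟨ ∑-except f a ⟩
  f a + sum (except a f)  ≤⟨ +-mono-≤ (f≤1 a) (∑-atMostOne (except a f) rest≤1 restUnique) ⟩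
  2                       ∎
  where
  open ≤-Reasoning
  rest≤1 : ∀ i → except a f i ≤ 1
  rest≤1 i = ≤-trans (except≤ a f i) (f≤1 i)
  restUnique : ∀ i j → except a f i ≢ 0 → except a f j ≢ 0 → i ≡ j
  restUnique i j nzᵢ nzⱼ with i ≟ j | except-support f nzᵢ | except-support f nzⱼ
  ... | yes i≡j | _ | _ = i≡j
  ... | no  i≢j | i≢a , fi≢0 | j≢a , fj≢0 =
        ⊥-elim (noThree fa≢0 fi≢0 fj≢0 (i≢a ∘ sym) (j≢a ∘ sym) i≢j)

∑∑-squeeze : ∀ {m n} {f g : Fin m → Fin n → ℕ} → (∀ i j → f i j ≤ g i j) →
  ∑[ i < m ] sum (g i) ≤ ∑[ i < m ] sum (f i) → ∀ i j → f i j ≡ g i j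
∑∑-squeeze f≤g ∑∑g≤∑∑f i =
  ∑-squeeze (f≤g i) (≤-reflexive (sym (∑-squeeze (λ i → ∑-mono (f≤g i)) ∑∑g≤∑∑f i)))

𝟙 : ∀ {p} {P : Set p} → Dec P → ℕ
𝟙 P? = if does P? then 1 else 0

𝟙≤1 : ∀ {p} {P : Set p} (P? : Dec P) → 𝟙 P? ≤ 1
𝟙≤1 (yes _) = ≤-refl
𝟙≤1 (no  _) = z≤n

𝟙-yes : ∀ {p} {P : Set p} (P? : Dec P) → P → 𝟙 P? ≡ 1
𝟙-yes (yes _) _  = refl
𝟙-yes (no ¬p) p  = ⊥-elim (¬p p)

𝟙-no : ∀ {p} {P : Set p} (P? : Dec P) → ¬ P → 𝟙 P? ≡ 0
𝟙-no (yes p) ¬p = ⊥-elim (¬p p)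
𝟙-no (no  _) _  = refl

𝟙-sound : ∀ {p} {P : Set p} (P? : Dec P) → 𝟙 P? ≢ 0 → P
𝟙-sound (yes p) _  = p
𝟙-sound (no  _) nz = ⊥-elim (nz refl)

count : ∀ {n} {P : Pred (Fin n) 0ℓ} → Decidable P → ℕ
count P? = sum (λ i → 𝟙 (P? i))

count-one : ∀ {n} {P : Pred (Fin n) 0ℓ} (P? : Decidable P) {a} → P a → 1 ≤ count P?
count-one P? {a} pa = subst (_≤ count P?) (𝟙-yes (P? a) pa) (term≤∑ (λ i → 𝟙 (P? i)) a)

count-two : ∀ {n} {P : Pred (Fin n) 0ℓ} (P? : Decidable P) {a b} →
  a ≢ b → P a → P b → 2 ≤ count P?
count-two P? {a} {b} a≢b pa pb =
  subst (_≤ count P?) (cong₂ _+_ (𝟙-yes (P? a) pa) (𝟙-yes (P? b) pb)) (∑-two (λ i → 𝟙 (P? i)) a≢b)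

∑∑𝟙-witness : ∀ {m n} {P : Fin m → Fin n → Set} (P? : ∀ i j → Dec (P i j)) →
  ∑[ i < m ] ∑[ j < n ] 𝟙 (P? i j) ≢ 0 → ∃₂ P
∑∑𝟙-witness P? ∑≢0 with ∑-nonzero _ ∑≢0
... | i , row≢0 with ∑-nonzero _ row≢0
...   | j , 𝟙≢0 = i , j , 𝟙-sound (P? i j) 𝟙≢0

count-single : ∀ {n} (a : Fin n) → count (λ i → i ≟ a) ≡ 1
count-single a = begin
  count (λ i → i ≟ a)                      ≡⟨ ∑-except _ a ⟩
  𝟙 (a ≟ a) + sum (except a (λ i → 𝟙 (i ≟ a)))
                                           ≡⟨ cong₂ _+_ (𝟙-yes (a ≟ a) refl) (∑-zero others) ⟩
  1                                        ∎
  where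
  open ≡-Reasoning
  others : ∀ i → except a (λ i → 𝟙 (i ≟ a)) i ≡ 0
  others i with i ≟ a
  ... | yes _ = refl
  ... | no  _ = refl

count-∪ : ∀ {n} {P Q : Pred (Fin n) 0ℓ} (P? : Decidable P) (Q? : Decidable Q) →
  count (P? ∪? Q?) ≤ count P? + count Q?
count-∪ P? Q? = ≤-trans (∑-mono pointwise) (≤-reflexive (∑-distrib-+ (λ i → 𝟙 (P? i)) (λ i → 𝟙 (Q? i))))
  where
  pointwise : ∀ i → 𝟙 ((P? ∪? Q?) i) ≤ 𝟙 (P? i) + 𝟙 (Q? i)
  pointwise i with P? i | Q? i
  ... | yes _ | yes _ = s≤s z≤n
  ... | yes _ | no  _ = ≤-refl
  ... | no  _ | yes _ = ≤-refl
  ... | no  _ | no  _ = z≤n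

count-three : ∀ {n} {P : Pred (Fin n) 0ℓ} (P? : Decidable P) {a b c} →
  a ≢ b → a ≢ c → b ≢ c → P a → P b → P c → 3 ≤ count P?
count-three P? {a} {b} {c} a≢b a≢c b≢c pa pb pc =
  subst (_≤ count P?) (cong₂ _+_ (cong₂ _+_ (𝟙-yes (P? a) pa) (𝟙-yes (P? b) pb)) (𝟙-yes (P? c) pc))
    (∑-three (λ i → 𝟙 (P? i)) a≢b a≢c b≢c)

count-pair≤2 : ∀ {n} (a b : Fin n) → count ((λ i → i ≟ a) ∪? (λ i → i ≟ b)) ≤ 2
count-pair≤2 a b = ≤-trans (count-∪ (λ i → i ≟ a) (λ i → i ≟ b))
                           (≤-reflexive (cong₂ _+_ (count-single a) (count-single b)))

count-triple≡3 : ∀ {n} {a b c : Fin n} → a ≢ b → a ≢ c → b ≢ c →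
  count ((λ i → i ≟ a) ∪? (λ i → i ≟ b) ∪? (λ i → i ≟ c)) ≡ 3
count-triple≡3 {a = a} {b} {c} a≢b a≢c b≢c = ≤-antisym
  (≤-trans (count-∪ (λ i → i ≟ a) ((λ i → i ≟ b) ∪? (λ i → i ≟ c)))
    (+-mono-≤ (≤-reflexive (count-single a)) (count-pair≤2 b c)))
  (count-three ((λ i → i ≟ a) ∪? (λ i → i ≟ b) ∪? (λ i → i ≟ c)) a≢b a≢c b≢c
    (inj₁ refl) (inj₂ (inj₁ refl)) (inj₂ (inj₂ refl)))

∑-pick : ∀ m {k} → k < m → (φ : ℕ → ℕ) → ∑[ i < m ] (𝟙 (k ℕ.≟ toℕ i) * φ (toℕ i)) ≡ φ k
∑-pick (suc m) {zero} _ φ = begin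
  1 * φ 0 + ∑[ i < m ] (𝟙 (0 ℕ.≟ suc (toℕ i)) * φ (suc (toℕ i)))
    ≡⟨ cong (1 * φ 0 +_) (∑-zero {m} (λ _ → refl)) ⟩
  1 * φ 0 + 0
    ≡⟨ +-identityʳ (1 * φ 0) ⟩
  1 * φ 0
    ≡⟨ *-identityˡ (φ 0) ⟩
  φ 0
    ∎
  where open ≡-Reasoning
∑-pick (suc m) {suc k} (s≤s k<m) φ = ∑-pick m k<m (φ ∘ suc)

∑-fibres : ∀ {n} m (h : Fin n → ℕ) → (∀ x → h x < m) → (φ : ℕ → ℕ) →
  ∑[ x < n ] φ (h x) ≡ ∑[ i < m ] (count (λ x → h x ℕ.≟ toℕ i) * φ (toℕ i))
∑-fibres {n} m h h<m φ = begin
  ∑[ x < n ] φ (h x)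
    ≡⟨ sum-cong-≗ {n} (λ x → ∑-pick m (h<m x) φ) ⟨
  ∑[ x < n ] ∑[ i < m ] (𝟙 (h x ℕ.≟ toℕ i) * φ (toℕ i))
    ≡⟨ ∑-comm {n} {m} (λ x i → 𝟙 (h x ℕ.≟ toℕ i) * φ (toℕ i)) ⟩
  ∑[ i < m ] ∑[ x < n ] (𝟙 (h x ℕ.≟ toℕ i) * φ (toℕ i))
    ≡⟨ sum-cong-≗ {m} (λ i → *-distribʳ-sum {n} (φ (toℕ i)) (λ x → 𝟙 (h x ℕ.≟ toℕ i))) ⟨
  ∑[ i < m ] (count (λ x → h x ℕ.≟ toℕ i) * φ (toℕ i))
    ∎
  where open ≡-Reasoning

-- k² = k + 2·C(k,2): the squares of the sphere sizes count ordered pairs of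
-- vertices at equal distance, C(k,2) the unordered pairs of distinct ones.
square-choose2 : ∀ k → k * k ≡ k * 1 + (k C 2) * 2
square-choose2 zero    = refl
square-choose2 (suc k) = begin
  suc k * suc k                       ≡⟨ solve 1 (λ k → (con 1 :+ k) :* (con 1 :+ k)
                                            := k :* k :+ (con 1 :+ k :+ k)) refl k ⟩
  k * k + (1 + k + k)                 ≡⟨ cong (_+ (1 + k + k)) (square-choose2 k) ⟩
  k * 1 + (k C 2) * 2 + (1 + k + k)   ≡⟨ solve 2 (λ k c → k :* con 1 :+ c :* con 2 :+ (con 1 :+ k :+ k)
                                            := (con 1 :+ k) :* con 1 :+ (k :+ c) :* con 2) refl k (k C 2) ⟩
  suc k * 1 + (k + k C 2) * 2         ≡⟨ cong (λ c → suc k * 1 + (c + k C 2) * 2) (nC1≡n k) ⟨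
  suc k * 1 + (k C 1 + k C 2) * 2     ≡⟨ cong (λ c → suc k * 1 + c * 2) (nCk+nC[k+1]≡[n+1]C[k+1] k 1) ⟩
  suc k * 1 + (suc k C 2) * 2         ∎
  where
  open ≡-Reasoning
  open +-*-Solver

subset : ∀ {n} {P : Pred (Fin n) 0ℓ} → Decidable P → Subset n
subset P? = Vec.tabulate (λ i → does (P? i))

∈-subset : ∀ {n} {P : Pred (Fin n) 0ℓ} (P? : Decidable P) {i} → P i → i ∈ subset P?
∈-subset {P = P} P? {i} p =
  lookup⇒[]= i (subset P?) (trans (lookup∘tabulate _ i) (does≡true (P? i)))
  where
  does≡true : (d : Dec (P i)) → does d ≡ true
  does≡true (yes _) = refl
  does≡true (no ¬p) = ⊥-elim (¬p p)

subset-∈ : ∀ {n} {P : Pred (Fin n) 0ℓ} (P? : Decidable P) {i} → i ∈ subset P? → P i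
subset-∈ {P = P} P? {i} i∈ =
  sound (P? i) (trans (sym (lookup∘tabulate (λ i → does (P? i)) i)) ([]=⇒lookup i∈))
  where
  sound : (d : Dec (P i)) → does d ≡ true → P i
  sound (yes p) _ = p
  sound (no _) ()

∣subset∣ : ∀ {n} {P : Pred (Fin n) 0ℓ} (P? : Decidable P) → ∣ subset P? ∣ ≡ count P?
∣subset∣ {zero}  P? = refl
∣subset∣ {suc n} P? = trans (size-∷ (does (P? fzero)) (subset (P? ∘ fsuc)))
                            (cong (𝟙 (P? fzero) +_) (∣subset∣ (P? ∘ fsuc)))
  where
  size-∷ : ∀ {k} b (p : Subset k) → ∣ b ∷ p ∣ ≡ (if b then 1 else 0) + ∣ p ∣
  size-∷ true  p = refl
  size-∷ false p = refl

half : ∀ m s → m * 2 ≡ 2 + s * 2 → s ≡ m ∸ 1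
half zero    s ()
half (suc m) s eq = sym (*-cancelʳ-≡ m s 2 (+-cancelˡ-≡ 2 (m * 2) (s * 2) eq))

≤-foldr-⊔ : ∀ {A : Set} {k} (t : Fin k → A) (f : A → ℕ) x →
  f (t x) ≤ foldr _⊔_ 0 (map f (tabulate t))
≤-foldr-⊔ t f fzero    = m≤m⊔n _ _
≤-foldr-⊔ t f (fsuc x) = ≤-trans (≤-foldr-⊔ (t ∘ fsuc) f x) (m≤n⊔m (f (t fzero)) _)

sum-applyUpTo : ∀ m (F h : ℕ → ℕ) → List.sum (map F (applyUpTo h m)) ≡ ∑[ i < m ] F (h (toℕ i))
sum-applyUpTo zero    F h = refl
sum-applyUpTo (suc m) F h = cong (F (h 0) +_) (sum-applyUpTo m F (h ∘ suc))

length-filter : ∀ {A : Set} {k} (t : Fin k → A) {P : Pred A 0ℓ} (P? : Decidable P) →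
  length (filter P? (tabulate t)) ≡ ∑[ j < k ] 𝟙 (P? (t j))
length-filter {k = zero}  t P? = refl
length-filter {k = suc k} t P? with P? (t fzero)
... | yes _ = cong suc (length-filter (t ∘ fsuc) P?)
... | no  _ = length-filter (t ∘ fsuc) P?

firstTrue≥ : ∀ {n} (G : Graph n) f s b → s ≤ firstTrue G f s b
firstTrue≥ G f s zero    = ≤-refl
firstTrue≥ G f s (suc b) with f s
... | true  = ≤-refl
... | false = ≤-trans (n≤1+n s) (firstTrue≥ G f (suc s) b)

dist-refl : ∀ {n} (G : Graph n) u → dist G u u ≡ 0
dist-refl {suc n} G u with u ≟ u
... | yes _   = refl
... | no u≢u = ⊥-elim (u≢u refl)

dist≡0⇒≡ : ∀ {n} (G : Graph n) {u v} → dist G u v ≡ 0 → u ≡ v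
dist≡0⇒≡ {suc n} G {u} {v} d≡0 with u ≟ v
... | yes u≡v = u≡v
... | no  _   with () ← ≤-trans (firstTrue≥ G (λ k → reach G k u v) 1 n) (≤-reflexive d≡0)

dist≤ecc : ∀ {n} (G : Graph n) u x → dist G u x ≤ ecc G u
dist≤ecc G u = ≤-foldr-⊔ (λ i → i) (dist G u)

module Blindness {n : ℕ} (G : Graph n) where

  d : Fin n → Fin n → ℕ
  d = dist G

  Blind : Fin n → Fin n → Fin n → Fin n → Set
  Blind u v x y = u ≢ v × x ≢ y × d u x ≡ d u y × d v x ≡ d v y

  blind? : ∀ u v x y → Dec (Blind u v x y)
  blind? u v x y = ¬? (u ≟ v) ×-dec ¬? (x ≟ y) ×-dec (d u x ℕ.≟ d u y) ×-dec (d v x ℕ.≟ d v y)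

  blind-flip : ∀ {u v x y} → Blind u v x y → Blind u v y x
  blind-flip (u≢v , x≢y , eu , ev) = u≢v , x≢y ∘ sym , sym eu , sym ev

  ¬resolves⇒blind : ∀ {u v x y} → u ≢ v → x ≢ y → ¬ PairResolves G u v x y → Blind u v x y
  ¬resolves⇒blind {u} {v} {x} {y} u≢v x≢y ¬res with d u x ℕ.≟ d u y | d v x ℕ.≟ d v y
  ... | yes eu | yes ev = u≢v , x≢y , eu , ev
  ... | no  ru | _      = ⊥-elim (¬res (inj₁ ru))
  ... | _      | no  rv = ⊥-elim (¬res (inj₂ rv))

  blind⇒¬resolves : ∀ {u v x y} → Blind u v x y → ¬ PairResolves G u v x y
  blind⇒¬resolves (_ , _ , eu , _) (inj₁ ru) = ru eu
  blind⇒¬resolves (_ , _ , _ , ev) (inj₂ rv) = rv ev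

  -- dim(G) ≥ 3 says that no two vertices form a resolving set: every pair of
  -- distinct vertices is blind to some pair.
  EveryPairBlind : Set
  EveryPairBlind = ∀ {u v} → u ≢ v → ∃₂ λ x y → Blind u v x y

  -- res(G) ≤ 3 says that every three vertices form a resolving set: no pair
  -- of distinct vertices is left unresolved by three distinct vertices.
  AtMostTwoNonResolvers : Set
  AtMostTwoNonResolvers = ∀ {x y a b c} → x ≢ y → a ≢ b → a ≢ c → b ≢ c →
    d a x ≡ d a y → d b x ≡ d b y → d c x ≡ d c y → ⊥

  everyPairBlind : (∀ S → ResolvingSet G S → 3 ≤ ∣ S ∣) → EveryPairBlind
  everyPairBlind minimal {u} {v} u≢v
    with any? (λ x → any? (λ y → ¬? (x ≟ y) ×-dec (d u x ℕ.≟ d u y) ×-dec (d v x ℕ.≟ d v y)))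
  ... | yes (x , y , x≢y , eu , ev) = x , y , u≢v , x≢y , eu , ev
  ... | no  noBlindSpot = ⊥-elim (3≰2 (≤-trans (minimal (subset uv?) resolving)
                                  (≤-trans (≤-reflexive (∣subset∣ uv?)) (count-pair≤2 u v))))
    where
    uv? : Decidable (λ i → i ≡ u ⊎ i ≡ v)
    uv? = (λ i → i ≟ u) ∪? (λ i → i ≟ v)
    resolving : ResolvingSet G (subset uv?)
    resolving x y x≢y with d u x ℕ.≟ d u y | d v x ℕ.≟ d v y
    ... | no  ru | _      = u , ∈-subset uv? (inj₁ refl) , ru
    ... | yes _  | no  rv = v , ∈-subset uv? (inj₂ refl) , rv
    ... | yes eu | yes ev = ⊥-elim (noBlindSpot (x , y , x≢y , eu , ev))
    3≰2 : ¬ (3 ≤ 2)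
    3≰2 (s≤s (s≤s ()))

  atMostTwoNonResolvers : AllResolving G 3 → AtMostTwoNonResolvers
  atMostTwoNonResolvers allResolving {x} {y} {a} {b} {c} x≢y a≢b a≢c b≢c ea eb ec =
    noResolver (allResolving (subset abc?) (trans (∣subset∣ abc?) (count-triple≡3 a≢b a≢c b≢c)) x y x≢y)
    where
    abc? : Decidable (λ i → i ≡ a ⊎ i ≡ b ⊎ i ≡ c)
    abc? = (λ i → i ≟ a) ∪? (λ i → i ≟ b) ∪? (λ i → i ≟ c)
    noResolver : (∃ λ w → w ∈ subset abc? × Resolves G w x y) → ⊥
    noResolver (w , w∈S , resolves) with subset-∈ abc? w∈S
    ... | inj₁ refl        = resolves ea
    ... | inj₂ (inj₁ refl) = resolves eb
    ... | inj₂ (inj₂ refl) = resolves ec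

  -- At most two vertices fail to resolve a pair, so a pair blind to {x,y} is unique.
  blindPair-unique : AtMostTwoNonResolvers → ∀ {a b a' b' x y} →
    Blind a b x y → Blind a' b' x y → SamePair G a b a' b'
  blindPair-unique atMostTwo {a} {b} {a'} {b'} (a≢b , x≢y , ea , eb) (a'≢b' , _ , ea' , eb')
    with a' ≟ a | a' ≟ b | b' ≟ a | b' ≟ b
  ... | yes a'≡a | _        | _        | yes b'≡b = inj₁ (a'≡a , b'≡b)
  ... | _        | yes a'≡b | yes b'≡a | _        = inj₂ (a'≡b , b'≡a)
  ... | yes refl | _        | _        | no  b'≢b = ⊥-elim (atMostTwo x≢y a≢b a'≢b' (b'≢b ∘ sym) ea eb eb')
  ... | _        | yes refl | no  b'≢a | _        = ⊥-elim (atMostTwo x≢y a≢b (b'≢a ∘ sym) a'≢b' ea eb eb')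
  ... | no  a'≢a | no  a'≢b | _        | _        = ⊥-elim (atMostTwo x≢y a≢b (a'≢a ∘ sym) (a'≢b ∘ sym) ea eb ea')

  blindSpots : Fin n → Fin n → ℕ
  blindSpots u v = ∑[ x < n ] count (blind? u v x)

  blindPairs : Fin n → Fin n → ℕ
  blindPairs x y = ∑[ u < n ] ∑[ v < n ] 𝟙 (blind? u v x y)

  offDiagonal : Fin n → Fin n → ℕ
  offDiagonal u = except u (λ _ → 2)

  offDiagonal-≢ : ∀ {u v} → u ≢ v → offDiagonal u v ≡ 2
  offDiagonal-≢ u≢v = except-≢ (λ _ → 2) (u≢v ∘ sym)

  ∑offDiagonal : ∀ u → n * 2 ≡ 2 + ∑[ v < n ] offDiagonal u v
  ∑offDiagonal u = trans (sym (∑-const n 2)) (∑-except (λ _ → 2) u)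

  -- Both totals count the quadruples (u,v,x,y) with (u,v) blind to (x,y).
  double-count : ∑[ u < n ] ∑[ v < n ] blindSpots u v ≡ ∑[ x < n ] ∑[ y < n ] blindPairs x y
  double-count = begin
    ∑[ u < n ] ∑[ v < n ] ∑[ x < n ] ∑[ y < n ] r u v x y
      ≡⟨ sum-cong-≗ {n} (λ u → ∑-comm {n} {n} (λ v x → ∑[ y < n ] r u v x y)) ⟩
    ∑[ u < n ] ∑[ x < n ] ∑[ v < n ] ∑[ y < n ] r u v x y
      ≡⟨ ∑-comm {n} {n} (λ u x → ∑[ v < n ] ∑[ y < n ] r u v x y) ⟩
    ∑[ x < n ] ∑[ u < n ] ∑[ v < n ] ∑[ y < n ] r u v x y
      ≡⟨ sum-cong-≗ {n} (λ x → sum-cong-≗ {n} (λ u → ∑-comm {n} {n} (λ v y → r u v x y))) ⟩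
    ∑[ x < n ] ∑[ u < n ] ∑[ y < n ] ∑[ v < n ] r u v x y
      ≡⟨ sum-cong-≗ {n} (λ x → ∑-comm {n} {n} (λ u y → ∑[ v < n ] r u v x y)) ⟩
    ∑[ x < n ] ∑[ y < n ] ∑[ u < n ] ∑[ v < n ] r u v x y
      ∎
    where
    open ≡-Reasoning
    r : Fin n → Fin n → Fin n → Fin n → ℕ
    r u v x y = 𝟙 (blind? u v x y)

  sphere : Fin n → ℕ → ℕ
  sphere u i = count (λ y → d u y ℕ.≟ i)

  sameSphere : Fin n → Fin n → Fin n → ℕ
  sameSphere u x = except x (λ y → 𝟙 (d u y ℕ.≟ d u x))

  sphere-through : ∀ u x → sphere u (d u x) ≡ 1 + sum (sameSphere u x)
  sphere-through u x = trans (∑-except (λ y → 𝟙 (d u y ℕ.≟ d u x)) x)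
                             (cong (_+ sum (sameSphere u x)) (𝟙-yes (d u x ℕ.≟ d u x) refl))

  sphere-0 : ∀ u → sphere u 0 ≡ 1
  sphere-0 u = begin
    sphere u 0                    ≡⟨ cong (sphere u) (dist-refl G u) ⟨
    sphere u (d u u)              ≡⟨ sphere-through u u ⟩
    1 + sum (sameSphere u u)      ≡⟨ cong (1 +_) (∑-zero others) ⟩
    1                             ∎
    where
    open ≡-Reasoning
    others : ∀ y → except u (λ y → 𝟙 (d u y ℕ.≟ d u u)) y ≡ 0
    others y with y ≟ u
    ... | yes _   = refl
    ... | no  y≢u = 𝟙-no (d u y ℕ.≟ d u u) (λ e → y≢u (sym (dist≡0⇒≡ G (trans e (dist-refl G u)))))

  -- Grouping the vertices x by the sphere containing them:
  -- Σ_x |N_{d(u,x)}(u)| = Σ_i |N_i(u)|² = n + 2 Σ_i C(|N_i(u)|,2).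
  ∑sphere-sizes : ∀ u → ∑[ x < n ] sphere u (d u x) ≡ n + (∑[ i < suc (ecc G u) ] (sphere u (toℕ i) C 2)) * 2
  ∑sphere-sizes u = begin
    ∑[ x < n ] sphere u (d u x)
      ≡⟨ ∑-fibres (suc (ecc G u)) (d u) d<1+ecc (sphere u) ⟩
    ∑[ i < suc (ecc G u) ] (N i * N i)
      ≡⟨ sum-cong-≗ {suc (ecc G u)} (λ i → square-choose2 (N i)) ⟩
    ∑[ i < suc (ecc G u) ] (N i * 1 + (N i C 2) * 2)
      ≡⟨ ∑-distrib-+ (λ i → N i * 1) (λ i → (N i C 2) * 2) ⟩
    ∑[ i < suc (ecc G u) ] (N i * 1) + ∑[ i < suc (ecc G u) ] ((N i C 2) * 2)
      ≡⟨ cong₂ _+_ (∑-fibres (suc (ecc G u)) (d u) d<1+ecc (λ _ → 1))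
                   (*-distribʳ-sum 2 (λ i → N i C 2)) ⟨
    ∑[ x < n ] 1 + (∑[ i < suc (ecc G u) ] (N i C 2)) * 2
      ≡⟨ cong (_+ (∑[ i < suc (ecc G u) ] (N i C 2)) * 2) (∑-ones n) ⟩
    n + (∑[ i < suc (ecc G u) ] (N i C 2)) * 2
      ∎
    where
    open ≡-Reasoning
    N : Fin (suc (ecc G u)) → ℕ
    N i = sphere u (toℕ i)
    d<1+ecc : ∀ x → d u x < suc (ecc G u)
    d<1+ecc x = s≤s (dist≤ecc G u x)

  -- The sum Σ_{1 ≤ i ≤ ecc(u)} of the statement may include the radius 0,
  -- whose term C(|N_0(u)|,2) = C(1,2) vanishes.
  sphereSum≡ : ∀ u → sphereSum G u ≡ ∑[ i < suc (ecc G u) ] (sphere u (toℕ i) C 2)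
  sphereSum≡ u = begin
    sphereSum G u
      ≡⟨ sum-applyUpTo (ecc G u) (λ i → sphereSize G u i C 2) suc ⟩
    ∑[ i < ecc G u ] (sphereSize G u (suc (toℕ i)) C 2)
      ≡⟨ sum-cong-≗ {ecc G u} (λ i → cong (_C 2) (length-filter (λ j → j) (λ y → d u y ℕ.≟ suc (toℕ i)))) ⟩
    ∑[ i < ecc G u ] (sphere u (suc (toℕ i)) C 2)
      ≡⟨ cong (λ k → k C 2 + ∑[ i < ecc G u ] (sphere u (suc (toℕ i)) C 2)) (sphere-0 u) ⟨
    ∑[ i < suc (ecc G u) ] (sphere u (toℕ i) C 2)
      ∎
    where open ≡-Reasoning

  module Counting (pairsBlind : EveryPairBlind) (atMostTwo : AtMostTwoNonResolvers) where

    partners≤1 : ∀ u x y → ∑[ v < n ] 𝟙 (blind? u v x y) ≤ 1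
    partners≤1 u x y = ∑-atMostOne _ (λ v → 𝟙≤1 (blind? u v x y)) unique
      where
      unique : ∀ v v' → 𝟙 (blind? u v x y) ≢ 0 → 𝟙 (blind? u v' x y) ≢ 0 → v ≡ v'
      unique v v' nz nz' with v ≟ v' | 𝟙-sound (blind? u v x y) nz | 𝟙-sound (blind? u v' x y) nz'
      ... | yes v≡v' | _ | _ = v≡v'
      ... | no  v≢v' | u≢v , x≢y , eu , ev | u≢v' , _ , _ , ev' =
            ⊥-elim (atMostTwo x≢y u≢v u≢v' v≢v' eu ev ev')

    -- A pair (x,y) has at most two non-resolvers, so at most two ordered
    -- pairs (u,v) are blind to it.
    blindPairs≤ : ∀ x y → blindPairs x y ≤ offDiagonal x y
    blindPairs≤ x y with y ≟ x
    ... | yes refl = ≤-reflexive (∑-zero (λ u → ∑-zero (λ v →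
                       𝟙-no (blind? u v x x) (λ (_ , x≢x , _) → x≢x refl))))
    ... | no  y≢x  = ∑-atMostTwo _ (λ u → partners≤1 u x y)
                       (λ pa pb pc a≢b a≢c b≢c → atMostTwo (y≢x ∘ sym) a≢b a≢c b≢c
                          (nonResolver pa) (nonResolver pb) (nonResolver pc))
      where
      nonResolver : ∀ {a} → ∑[ v < n ] 𝟙 (blind? a v x y) ≢ 0 → d a x ≡ d a y
      nonResolver {a} nz with ∑-nonzero (λ v → 𝟙 (blind? a v x y)) nz
      ... | v , 𝟙≢0 with 𝟙-sound (blind? a v x y) 𝟙≢0
      ...   | _ , _ , ea , _ = ea

    -- A pair u ≠ v is blind to some (x,y), hence also to (y,x).
    blindSpots≥ : ∀ u v → offDiagonal u v ≤ blindSpots u v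
    blindSpots≥ u v with v ≟ u
    ... | yes _   = z≤n
    ... | no  v≢u with pairsBlind (v≢u ∘ sym)
    ...   | x , y , blind@(_ , x≢y , _) =
            ≤-trans (+-mono-≤ (count-one (blind? u v x) blind) (count-one (blind? u v y) (blind-flip blind)))
                    (∑-two (λ a → count (blind? u v a)) x≢y)

    -- Since both totals agree, both bounds are equalities.
    ∑blindSpots≤∑offDiagonal : ∑[ u < n ] ∑[ v < n ] blindSpots u v ≤ ∑[ u < n ] ∑[ v < n ] offDiagonal u v
    ∑blindSpots≤∑offDiagonal =
      ≤-trans (≤-reflexive double-count) (∑-mono (λ x → ∑-mono (blindPairs≤ x)))

    blindSpots≡ : ∀ {u v} → u ≢ v → blindSpots u v ≡ 2
    blindSpots≡ {u} {v} u≢v =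
      trans (sym (∑∑-squeeze blindSpots≥ ∑blindSpots≤∑offDiagonal u v)) (offDiagonal-≢ u≢v)

    blindPairs≡ : ∀ {x y} → x ≢ y → blindPairs x y ≡ 2
    blindPairs≡ {x} {y} x≢y = trans (∑∑-squeeze blindPairs≤ ∑offDiagonal≤∑blindPairs x y) (offDiagonal-≢ x≢y)
      where
      ∑offDiagonal≤∑blindPairs : ∑[ u < n ] ∑[ v < n ] offDiagonal u v ≤ ∑[ x < n ] ∑[ y < n ] blindPairs x y
      ∑offDiagonal≤∑blindPairs = ≤-trans (∑-mono (λ u → ∑-mono (blindSpots≥ u))) (≤-reflexive double-count)

    tooMany : ∀ {u v} → u ≢ v → 3 ≤ blindSpots u v → ⊥
    tooMany u≢v 3≤ with ≤-trans 3≤ (≤-reflexive (blindSpots≡ u≢v))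
    ... | s≤s (s≤s ())

    -- Part (a), first half: a pair {u,v} is blind to only one pair {x,y},
    -- since a second one would put a third ordered pair into blindSpots u v = 2.
    blindSpot-unique : ∀ {u v x y x' y'} → Blind u v x y → Blind u v x' y' → SamePair G x y x' y'
    blindSpot-unique {u} {v} {x} {y} {x'} {y'} blind@(u≢v , x≢y , _) blind'
      with x' ≟ x | x' ≟ y | y' ≟ x | y' ≟ y
    ... | yes x'≡x | _        | _        | yes y'≡y = inj₁ (x'≡x , y'≡y)
    ... | _        | yes x'≡y | yes y'≡x | _        = inj₂ (x'≡y , y'≡x)
    ... | yes refl | _        | _        | no  y'≢y =
          ⊥-elim $ tooMany u≢v (≤-trans (+-mono-≤ (count-two (blind? u v x) (y'≢y ∘ sym) blind blind')
                                     (count-one (blind? u v y) (blind-flip blind)))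
                           (∑-two (λ a → count (blind? u v a)) x≢y))
    ... | _        | yes refl | no  y'≢x | _        =
          ⊥-elim $ tooMany u≢v (≤-trans (+-mono-≤ (count-one (blind? u v x) blind)
                                     (count-two (blind? u v y) (y'≢x ∘ sym) (blind-flip blind) blind'))
                           (∑-two (λ a → count (blind? u v a)) x≢y))
    ... | no  x'≢x | no  x'≢y | _        | _        =
          ⊥-elim $ tooMany u≢v (≤-trans (+-mono-≤ (+-mono-≤ (count-one (blind? u v x) blind)
                                               (count-one (blind? u v y) (blind-flip blind)))
                                     (count-one (blind? u v x') blind'))
                           (∑-three (λ a → count (blind? u v a)) x≢y (x'≢x ∘ sym) (x'≢y ∘ sym)))

    blindPair-exists : ∀ {x y} → x ≢ y → ∃₂ λ a b → Blind a b x y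
    blindPair-exists {x} {y} x≢y =
      ∑∑𝟙-witness (λ a b → blind? a b x y) (λ ∑≡0 → 0≢2 (trans (sym ∑≡0) (blindPairs≡ x≢y)))
      where
      0≢2 : 0 ≢ 2
      0≢2 ()

    -- Part (b): for x ≠ y at equal distance from u exactly one v makes {u,v}
    -- blind to {x,y}, namely the non-resolver of {x,y} other than u.
    partner-exists : ∀ {u x y} → x ≢ y → d u x ≡ d u y → ∃ λ v → Blind u v x y
    partner-exists {u} {x} {y} x≢y eu = choose (blindPair-exists x≢y)
      where
      choose : (∃₂ λ a b → Blind a b x y) → ∃ λ v → Blind u v x y
      choose (a , b , blind) with a ≟ u
      ... | yes a≡u = b , subst (λ w → Blind w b x y) a≡u blind
      ... | no  a≢u = a , (a≢u ∘ sym) , x≢y , eu , proj₁ (proj₂ (proj₂ blind))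

    sameSphere≡partners : ∀ u x y → sameSphere u x y ≡ ∑[ v < n ] 𝟙 (blind? u v x y)
    sameSphere≡partners u x y = byCases (y ≟ x) (d u y ℕ.≟ d u x)
      where
      noPartner : (∀ v → ¬ Blind u v x y) → 0 ≡ ∑[ v < n ] 𝟙 (blind? u v x y)
      noPartner none = sym (∑-zero (λ v → 𝟙-no (blind? u v x y) (none v)))
      byCases : Dec (y ≡ x) → Dec (d u y ≡ d u x) → sameSphere u x y ≡ ∑[ v < n ] 𝟙 (blind? u v x y)
      byCases (yes y≡x) _ =
        trans (except-≡ (λ y → 𝟙 (d u y ℕ.≟ d u x)) y≡x) (noPartner (λ v (_ , x≢y , _) → x≢y (sym y≡x)))
      byCases (no y≢x) (no ne) =
        trans (except-≢ (λ y → 𝟙 (d u y ℕ.≟ d u x)) y≢x)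
              (trans (𝟙-no (d u y ℕ.≟ d u x) ne) (noPartner (λ v (_ , _ , eu , _) → ne (sym eu))))
      byCases (no y≢x) (yes e) =
        trans (except-≢ (λ y → 𝟙 (d u y ℕ.≟ d u x)) y≢x)
              (trans (𝟙-yes (d u y ℕ.≟ d u x) e)
                     (≤-antisym (count-one (λ v → blind? u v x y) (proj₂ (partner-exists (y≢x ∘ sym) (sym e))))
                                (partners≤1 u x y)))

    ∑sameSphere : ∀ u → ∑[ x < n ] sum (sameSphere u x) ≡ ∑[ v < n ] offDiagonal u v
    ∑sameSphere u = begin
      ∑[ x < n ] ∑[ y < n ] sameSphere u x y
        ≡⟨ sum-cong-≗ {n} (λ x → sum-cong-≗ {n} (sameSphere≡partners u x)) ⟩
      ∑[ x < n ] ∑[ y < n ] ∑[ v < n ] r x y v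
        ≡⟨ sum-cong-≗ {n} (λ x → ∑-comm {n} {n} (r x)) ⟩
      ∑[ x < n ] ∑[ v < n ] ∑[ y < n ] r x y v
        ≡⟨ ∑-comm {n} {n} (λ x v → ∑[ y < n ] r x y v) ⟩
      ∑[ v < n ] blindSpots u v
        ≡⟨ sum-cong-≗ {n} (λ v → ∑∑-squeeze blindSpots≥ ∑blindSpots≤∑offDiagonal u v) ⟨
      ∑[ v < n ] offDiagonal u v
        ∎
      where
      open ≡-Reasoning
      r : Fin n → Fin n → Fin n → ℕ
      r x y v = 𝟙 (blind? u v x y)

    -- Comparing the two counts of Σ_x |N_{d(u,x)}(u)|: 2 Σ_i C(|N_i(u)|,2) = 2(n-1).
    twiceSphereSum : ∀ u → (∑[ i < suc (ecc G u) ] (sphere u (toℕ i) C 2)) * 2 ≡ ∑[ v < n ] offDiagonal u v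
    twiceSphereSum u = sym (+-cancelˡ-≡ n _ _ (begin
      n + ∑[ v < n ] offDiagonal u v                     ≡⟨ cong (n +_) (∑sameSphere u) ⟨
      n + ∑[ x < n ] sum (sameSphere u x)                ≡⟨ cong (_+ ∑[ x < n ] sum (sameSphere u x)) (∑-ones n) ⟨
      ∑[ x < n ] 1 + ∑[ x < n ] sum (sameSphere u x)     ≡⟨ ∑-distrib-+ (λ _ → 1) (λ x → sum (sameSphere u x)) ⟨
      ∑[ x < n ] (1 + sum (sameSphere u x))              ≡⟨ sum-cong-≗ {n} (sphere-through u) ⟨
      ∑[ x < n ] sphere u (d u x)                        ≡⟨ ∑sphere-sizes u ⟩
      n + (∑[ i < suc (ecc G u) ] (sphere u (toℕ i) C 2)) * 2 ∎))
      where open ≡-Reasoning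

    sphereSum≡n∸1 : ∀ u → sphereSum G u ≡ n ∸ 1
    sphereSum≡n∸1 u = trans (sphereSum≡ u)
      (half n _ (trans (∑offDiagonal u) (cong (2 +_) (sym (twiceSphereSum u)))))

    unresolvedPair : ∀ {u v} → u ≢ v →
      ∃ λ x → ∃ λ y → x ≢ y × ¬ PairResolves G u v x y
        × (∀ x' y' → x' ≢ y' → ¬ PairResolves G u v x' y' → SamePair G x y x' y')
    unresolvedPair {u} {v} u≢v = fromBlind (pairsBlind u≢v)
      where
      fromBlind : (∃₂ λ x y → Blind u v x y) → ∃ λ x → ∃ λ y → x ≢ y × ¬ PairResolves G u v x y
        × (∀ x' y' → x' ≢ y' → ¬ PairResolves G u v x' y' → SamePair G x y x' y')
      fromBlind (x , y , blind@(_ , x≢y , _)) =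
        x , y , x≢y , blind⇒¬resolves blind , λ x' y' x'≢y' ¬res →
          blindSpot-unique blind (¬resolves⇒blind u≢v x'≢y' ¬res)

    nonResolvingPair : ∀ {u v} → u ≢ v →
      ∃ λ r → ∃ λ s → r ≢ s × ¬ PairResolves G r s u v
        × (∀ r' s' → r' ≢ s' → ¬ PairResolves G r' s' u v → SamePair G r s r' s')
    nonResolvingPair {u} {v} u≢v = fromBlind (blindPair-exists u≢v)
      where
      fromBlind : (∃₂ λ r s → Blind r s u v) → ∃ λ r → ∃ λ s → r ≢ s × ¬ PairResolves G r s u v
        × (∀ r' s' → r' ≢ s' → ¬ PairResolves G r' s' u v → SamePair G r s r' s')
      fromBlind (r , s , blind@(r≢s , _)) =
        r , s , r≢s , blind⇒¬resolves blind , λ r' s' r'≢s' ¬res →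
          blindPair-unique atMostTwo blind (¬resolves⇒blind r'≢s' u≢v ¬res)

lemma2p1 : (n : ℕ) (G : Graph n) → Connected G → IsMetricDim G 3 → IsResNum G 3 →
    ((u v : Fin n) → u ≢ v →
      (∃ λ x → ∃ λ y → x ≢ y × ¬ PairResolves G u v x y
        × (∀ x' y' → x' ≢ y' → ¬ PairResolves G u v x' y' → SamePair G x y x' y'))
      × (∃ λ r → ∃ λ s → r ≢ s × ¬ PairResolves G r s u v
        × (∀ r' s' → r' ≢ s' → ¬ PairResolves G r' s' u v → SamePair G r s r' s')))
    × ((u : Fin n) → sphereSum G u ≡ n ∸ 1)
lemma2p1 n G _ (_ , dimMinimal) (allResolving , _) =
  (λ u v u≢v → unresolvedPair u≢v , nonResolvingPair u≢v) , sphereSum≡n∸1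
  where
  open Blindness G
  open Counting (everyPairBlind dimMinimal) (atMostTwoNonResolvers allResolving)
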